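{- Let $\mathbf{G}'$ be an oriented graph with $\mathbf{e}'$ edges, $e'_i$ running from $v'_{\operatorname{tail}(i)}$ to $v'_{\operatorname{head}(i)}$, let $n\ge 2$, let $\mathbf{G}$ be obtained by subdividing each edge into $n$ edges, let $X$ be an embedding of $\mathbf{G}$ in $\mathbb{R}^d$, and let $S=(S_n)^{\mathbf{e}'}$. For each $i\in\{1,\dots,\mathbf{e}'\}$, $\mu(P_i)=\mu(M_i)=m'_i$.
   Context: Subdivision: edge $e'_i$ is replaced by edges $e_{i,1},\dots,e_{i,n}$ through new vertices $v_{i,1},\dots,v_{i,n-1}$ in order from $v'_{\operatorname{tail}(i)}$ to $v'_{\operatorname{head}(i)}$. An embedding $X$ gives positions $x'_k$ for the vertices of $\mathbf{G}'$ and $x_{i,j}$ for $v_{i,j}$; $w_{i,j}$ is the displacement (head minus tail position) of $e_{i,j}$. For $\sigma=(\sigma_1,\dots,\sigma_{\mathbf{e}'})\in S$, $x^\sigma_{i,j}=x'_{\operatorname{tail}(i)}+\sum_{k=1}^j w_{i,\sigma_i(k)}$ and $X^\sigma_i=(x^\sigma_{i,1},\dots,x^\sigma_{i,n-1})$. The center of mass cloud $M_i$ is the point cloud indexed by $\sigma\in S$ with points $\mu(X^\sigma_i)=\frac{1}{n-1}\sum_{j=1}^{n-1}x^\sigma_{i,j}$; the parent cloud $P_i$ is the point cloud indexed by $(j,\sigma)\in\{1,\dots,n-1\}\times S$ with points $x^\sigma_{i,j}$; all weights are 1 and $\mu$ denotes the (unweighted) center of mass. $m'_i=\frac12(x'_{\operatorname{head}(i)}+x'_{\operatorname{tail}(i)})$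 is the midpoint of edge $e'_i$. -}

module Defs where

open import Level using (Level)
open import Algebra.Bundles using (CommutativeRing)
open import Data.Nat using (ℕ; zero; suc; _∸_; _<?_; _≤ᵇ_)
open import Data.Fin using (Fin; toℕ; fromℕ<)
open import Data.Fin.Properties using (all?; _≟_)
open import Data.Bool using (if_then_else_)
open import Data.List using (List; []; _∷_; [_]; map; concatMap; filter; length; foldr; allFin)
open import Data.Vec.Functional using (Vector) renaming (_∷_ to _∷ᶠ_)
open import Data.Product using (_×_)
open import Relation.Nullary using (yes; no)
open import Relation.Nullary.Decidable using (_→-dec_)
open import Relation.Binary.PropositionalEquality using (_≡_)

funs : ∀ {a} {A : Set a} (k : ℕ) → List A → List (Fin k → A)
funs zero    L = [ (λ ()) ]
funs (suc k) L = concatMap (λ a → map (λ f → a ∷ᶠ f) (funs k L)) L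

-- a map Fin n → Fin n is a permutation iff it is injective
IsPerm : (n : ℕ) → (Fin n → Fin n) → Set
IsPerm n f = ∀ i j → f i ≡ f j → i ≡ j

-- S_n : the symmetric group on n letters (0-based: letters are Fin n),
-- listed once each
Sym : (n : ℕ) → List (Fin n → Fin n)
Sym n = filter (λ f → all? (λ i → all? (λ j → (f i ≟ f j) →-dec (i ≟ j))))
               (funs n (allFin n))

SymPow : (n e' : ℕ) → List (Fin e' → Fin n → Fin n)
SymPow n e' = funs e' (Sym n)

-- Geometry over a commutative ring R in which every positive integer is
-- invertible (e.g. ℝ); `inv k` is meant to be 1/k.

module Setup {c ℓ : Level} (R : CommutativeRing c ℓ) (inv : ℕ → CommutativeRing.Carrier R) where
  open CommutativeRing R

  fromℕ : ℕ → Carrier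
  fromℕ zero    = 0#
  fromℕ (suc k) = 1# + fromℕ k

  Point : ℕ → Set c
  Point d = Fin d → Carrier

  _≈ₚ_ : ∀ {d} → Point d → Point d → Set ℓ
  p ≈ₚ q = ∀ t → p t ≈ q t

  _⊕_ : ∀ {d} → Point d → Point d → Point d
  (p ⊕ q) t = p t + q t

  _⊖_ : ∀ {d} → Point d → Point d → Point d
  (p ⊖ q) t = p t - q t

  _•_ : ∀ {d} → Carrier → Point d → Point d
  (a • p) t = a * p t

  𝟎 : ∀ {d} → Point d
  𝟎 t = 0#

  ΣL : ∀ {d} → List (Point d) → Point d
  ΣL = foldr _⊕_ 𝟎

  ΣF : ∀ {d} (k : ℕ) → (Fin k → Point d) → Point d
  ΣF k f = ΣL (map f (allFin k))

  -- a point cloud with all weights 1 is a list of points (indexed by the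
  -- position in the list); μ is its (unweighted) center of mass
  μ : ∀ {d} → List (Point d) → Point d
  μ P = inv (length P) • ΣL P

  -- The subdivision setting.
  --   v'       : number of vertices of G'
  --   e'       : number of edges of G'
  --   tl, hd   : tail / head of each edge e'_i
  --   n        : number of pieces each edge is subdivided into
  --   x'       : positions of the vertices of G'
  --   x i j    : position of the new vertex v_{i, j+1}  (j : Fin (n ∸ 1),
  --              0-based, so x i j stands for x_{i,j+1})
  module Subdivision {d v' e' : ℕ} (tl hd : Fin e' → Fin v') (n : ℕ)
                     (x' : Fin v' → Point d) (x : Fin e' → Fin (n ∸ 1) → Point d) where

    pos : Fin e' → ℕ → Point d
    pos i zero = x' (tl i)
    pos i (suc j) with j <? (n ∸ 1)
    ... | yes p = x i (fromℕ< p)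
    ... | no  _ = x' (hd i)

    -- w i k = w_{i,k+1} = displacement of edge e_{i,k+1}, k : Fin n
    w : Fin e' → Fin n → Point d
    w i k = pos i (suc (toℕ k)) ⊖ pos i (toℕ k)

    -- x^σ_{i,j+1} = x'_{tail(i)} + Σ_{k=1}^{j+1} w_{i,σ_i(k)}   (0-based j)
    xσ : (Fin e' → Fin n → Fin n) → Fin e' → Fin (n ∸ 1) → Point d
    xσ σ i j = x' (tl i) ⊕ ΣF n (λ k → if toℕ k ≤ᵇ toℕ j then w i (σ i k) else 𝟎)

    Xσ : (Fin e' → Fin n → Fin n) → Fin e' → List (Point d)
    Xσ σ i = map (xσ σ i) (allFin (n ∸ 1))

    S : List (Fin e' → Fin n → Fin n)
    S = SymPow n e'

    M : Fin e' → List (Point d)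
    M i = map (λ σ → μ (Xσ σ i)) S

    P : Fin e' → List (Point d)
    P i = concatMap (λ j → map (λ σ → xσ σ i j) S) (allFin (n ∸ 1))

    m' : Fin e' → Point d
    m' i = inv 2 • (x' (hd i) ⊕ x' (tl i))

module Submission where

-- Reverse every σᵢ (σᵢ ↦ σᵢ ∘ opposite) and, for Pᵢ, also the vertex index (j ↦ n − 2 − j,
-- 0-based). The reversed walk takes the same steps in the opposite order, so x^σ_{i,j} and its
-- image sum to x'_tail + x'_head. Both reindexings are bijections of the index set, so twice the
-- total of each cloud is (its size) · (x'_tail + x'_head), and the centre of mass is m'ᵢ.

open import Defs
open import Level using (Level)
open import Algebra.Bundles using (CommutativeRing)
open import Data.Nat using (ℕ; suc; _≤_; _∸_)
open import Data.Fin using (Fin)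
open import Data.Product using (_×_)

open import Data.Nat as ℕ using (zero; z≤n; s≤s; _≤ᵇ_)
import Data.Nat.Properties as ℕ
open import Data.Fin as Fin using (zero; suc; toℕ; inject₁; opposite; punchOut)
open import Data.Fin.Properties
  using (_≟_; all?; any?; opposite-involutive; opposite-prop; punchOut-injective; injective⇒≤; toℕ<n)
open import Data.Fin.Permutation using (Permutation; permutation)
open import Data.Vec.Functional using (Vector; reverse; insertAt; init) renaming (_∷_ to _∷ᶠ_)
open import Data.Vec.Functional.Relation.Binary.Pointwise using (Pointwise)
open import Data.List using (List; []; _∷_; _++_; map; concat; concatMap; filter; length; allFin; tabulate)
open import Data.List.Properties using (length-map; length-tabulate)
open import Data.List.Membership.Propositional using (_∈_)
open import Data.List.Membership.Propositional.Properties using (∈-allFin)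
open import Data.List.Relation.Unary.All as All using (All; []; _∷_)
import Data.List.Relation.Unary.All.Properties as All
open import Data.List.Relation.Unary.Any as Any using (Any; here; there)
import Data.List.Relation.Unary.Any.Properties as Any
open import Data.Bool using (true; false; not; if_then_else_)
open import Data.Product using (_,_; ∃; proj₁; proj₂)
open import Data.Sum using ([_,_]′)
open import Data.Unit using (⊤; tt)
open import Data.Empty using (⊥; ⊥-elim)
open import Function using (_∘_; id; mk⇔)
open import Relation.Nullary using (Dec; yes; no; does; ¬_; ¬?)
open import Relation.Nullary.Decidable using (_→-dec_; does-⇔)
open import Relation.Binary using (Rel; Reflexive; _Preserves_⟶_)
open import Relation.Binary.PropositionalEquality as ≡ using (_≡_; _≗_)

private
  variable
    a b r : Level
    A : Set a
    B : Set b
    k : ℕ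

module _ {n : ℕ} where

  IsPerm-resp : {f g : Fin n → Fin n} → f ≗ g → IsPerm n f → IsPerm n g
  IsPerm-resp f≗g f-inj i j gi≡gj = f-inj i j (≡.trans (f≗g i) (≡.trans gi≡gj (≡.sym (f≗g j))))

  IsPerm-id : IsPerm n id
  IsPerm-id i j = id

  IsPerm-reverse : {f : Fin n → Fin n} → IsPerm n f → IsPerm n (reverse f)
  IsPerm-reverse f-inj i j eq =
    ≡.trans (≡.sym (opposite-involutive i)) (≡.trans (≡.cong opposite (f-inj _ _ eq)) (opposite-involutive j))

  IsPerm-reverse⁻ : {f : Fin n → Fin n} → IsPerm n (reverse f) → IsPerm n f
  IsPerm-reverse⁻ {f = f} rf-inj = IsPerm-resp (≡.cong f ∘ opposite-involutive) (IsPerm-reverse rf-inj)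

  -- Literally the test in Defs.Sym, so that sums over Sym n unfold with sumL-filter.
  IsPerm? : (f : Fin n → Fin n) → Dec (IsPerm n f)
  IsPerm? f = all? (λ i → all? (λ j → (f i ≟ f j) →-dec (i ≟ j)))

-- Pigeonhole: a value y missed by f would let f be squeezed injectively into Fin (n - 1).
IsPerm-surjective : ∀ {n} {f : Fin n → Fin n} → IsPerm n f → ∀ y → ∃ λ x → f x ≡ y
IsPerm-surjective {suc n} {f} f-inj y with any? (λ x → f x ≟ y)
... | yes hit = hit
... | no miss = ⊥-elim (ℕ.<-irrefl ≡.refl (injective⇒≤ squeeze-injective))
  where
  f≢y : ∀ x → y ≡ f x → ⊥
  f≢y x y≡fx = miss (x , ≡.sym y≡fx)
  squeeze : Fin (suc n) → Fin n
  squeeze x = punchOut (f≢y x)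
  squeeze-injective : ∀ {x x'} → squeeze x ≡ squeeze x' → x ≡ x'
  squeeze-injective {x} {x'} eq = f-inj x x' (punchOut-injective (f≢y x) (f≢y x') eq)

IsPerm⇒Permutation : ∀ {n} {f : Fin n → Fin n} → IsPerm n f → Permutation n n
IsPerm⇒Permutation {f = f} f-inj =
  permutation f (proj₁ ∘ surj) (proj₂ ∘ surj) (λ x → f-inj _ _ (proj₂ (surj (f x))))
  where surj = IsPerm-surjective f-inj

funs-complete : ∀ k (L : List A) (g : Fin k → A) → (∀ i → g i ∈ L) → Any (_≗ g) (funs k L)
funs-complete zero    L g g∈L = here (λ ())
funs-complete (suc k) L g g∈L = Any.concatMap⁺ _ (Any.map extend (g∈L zero))
  where
  extend : ∀ {a} → g zero ≡ a → Any (_≗ g) (map (a ∷ᶠ_) (funs k L))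
  extend ≡.refl = Any.map⁺ (Any.map (λ f≗g → λ { zero → ≡.refl ; (suc i) → f≗g i })
                                    (funs-complete k L (g ∘ suc) (g∈L ∘ suc)))

All-funs : ∀ {P : A → Set r} (L : List A) → All P L → ∀ k → All (λ f → ∀ i → P (f i)) (funs k L)
All-funs L all zero    = (λ ()) ∷ []
All-funs {P = P} L all (suc k) = All.concat⁺ (All.map⁺ (All.map extend all))
  where
  extend : ∀ {a} → P a → All (λ f → ∀ i → P (f i)) (map (a ∷ᶠ_) (funs k L))
  extend Pa = All.map⁺ (All.map (λ Pf → λ { zero → Pa ; (suc i) → Pf i }) (All-funs L all k))

funs-nonempty : ∀ k {L : List A} → Any (λ _ → ⊤) L → Any (λ _ → ⊤) (funs k L)
funs-nonempty zero    _ = here tt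
funs-nonempty (suc k) L≠[] = Any.concatMap⁺ _ (Any.map (λ _ → Any.map⁺ (funs-nonempty k L≠[])) L≠[])

All-Sym : ∀ n → All (IsPerm n) (Sym n)
All-Sym n = All.all-filter IsPerm? (funs n (allFin n))

All-SymPow : ∀ n e' → All (λ σ → ∀ i → IsPerm n (σ i)) (SymPow n e')
All-SymPow n e' = All-funs (Sym n) (All-Sym n) e'

Sym-nonempty : ∀ n → Any (λ _ → ⊤) (Sym n)
Sym-nonempty n = Any.map (λ _ → tt) ([ id , (λ ¬perm → ⊥-elim (¬perm (Any.lookup-result perms))) ]′
                                     (Any.filter⁺ IsPerm? perms))
  where
  perms : Any (IsPerm n) (funs n (allFin n))
  perms = Any.map (λ f≗id → IsPerm-resp (≡.sym ∘ f≗id) IsPerm-id) (funs-complete n (allFin n) id ∈-allFin)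

SymPow-nonempty : ∀ n e' → Any (λ _ → ⊤) (SymPow n e')
SymPow-nonempty n e' = funs-nonempty e' (Sym-nonempty n)

≤ᵇ-opposite : ∀ {m} (i : Fin (suc m)) (j : Fin m) →
              (toℕ (opposite i) ≤ᵇ toℕ (opposite j)) ≡ not (toℕ i ≤ᵇ toℕ j)
≤ᵇ-opposite {m} i j =
  does-⇔ (mk⇔ to from) (toℕ (opposite i) ℕ.≤? toℕ (opposite j)) (¬? (toℕ i ℕ.≤? toℕ j))
  where
  to : toℕ (opposite i) ≤ toℕ (opposite j) → ¬ (toℕ i ≤ toℕ j)
  to oi≤oj i≤j = ℕ.<⇒≱ (begin-strict
    toℕ (opposite j)    ≡⟨ opposite-prop j ⟩
    m ∸ suc (toℕ j)     <⟨ ℕ.∸-monoʳ-< (s≤s i≤j) (toℕ<n j) ⟩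
    m ∸ toℕ i           ≡⟨ opposite-prop i ⟨
    toℕ (opposite i)    ∎) oi≤oj
    where open ℕ.≤-Reasoning
  from : ¬ (toℕ i ≤ toℕ j) → toℕ (opposite i) ≤ toℕ (opposite j)
  from i≰j = begin
    toℕ (opposite i)    ≡⟨ opposite-prop i ⟩
    m ∸ toℕ i           ≤⟨ ℕ.∸-monoʳ-≤ m (ℕ.≰⇒> i≰j) ⟩
    m ∸ suc (toℕ j)     ≡⟨ opposite-prop j ⟨
    toℕ (opposite j)    ∎
    where open ℕ.≤-Reasoning

module FiniteSums {c ℓ} (R : CommutativeRing c ℓ) where
  open CommutativeRing R hiding (zero)
  open import Relation.Binary.Reasoning.Setoid setoid
  open import Algebra.Properties.CommutativeMonoid.Sum +-commutativeMonoid using (sum; sum-permute)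
  open import Algebra.Properties.CommutativeSemigroup +-commutativeSemigroup using (interchange)

  sumL : List A → (A → Carrier) → Carrier
  sumL []       f = 0#
  sumL (x ∷ xs) f = f x + sumL xs f

  sumL-cong : (L : List A) {f g : A → Carrier} → (∀ x → f x ≈ g x) → sumL L f ≈ sumL L g
  sumL-cong []      f≈g = refl
  sumL-cong (x ∷ L) f≈g = +-cong (f≈g x) (sumL-cong L f≈g)

  sumL-cong-All : {L : List A} {f g : A → Carrier} → All (λ x → f x ≈ g x) L → sumL L f ≈ sumL L g
  sumL-cong-All []           = refl
  sumL-cong-All (fx≈gx ∷ ps) = +-cong fx≈gx (sumL-cong-All ps)

  sumL-zero : (L : List A) → sumL L (λ _ → 0#) ≈ 0#
  sumL-zero []      = refl
  sumL-zero (x ∷ L) = trans (+-identityˡ _) (sumL-zero L)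

  sumL-distrib-+ : (L : List A) (f g : A → Carrier) → sumL L (λ x → f x + g x) ≈ sumL L f + sumL L g
  sumL-distrib-+ []      f g = sym (+-identityˡ 0#)
  sumL-distrib-+ (x ∷ L) f g = trans (+-congˡ (sumL-distrib-+ L f g)) (interchange _ _ _ _)

  sumL-++ : (L K : List A) (f : A → Carrier) → sumL (L ++ K) f ≈ sumL L f + sumL K f
  sumL-++ []      K f = sym (+-identityˡ _)
  sumL-++ (x ∷ L) K f = trans (+-congˡ (sumL-++ L K f)) (sym (+-assoc _ _ _))

  sumL-map : (L : List B) (g : B → A) (f : A → Carrier) → sumL (map g L) f ≡ sumL L (f ∘ g)
  sumL-map []      g f = ≡.refl
  sumL-map (x ∷ L) g f = ≡.cong (f (g x) +_) (sumL-map L g f)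

  sumL-concatMap : (L : List B) (h : B → List A) (f : A → Carrier) →
                   sumL (concatMap h L) f ≈ sumL L (λ y → sumL (h y) f)
  sumL-concatMap []      h f = refl
  sumL-concatMap (y ∷ L) h f = trans (sumL-++ (h y) (concat (map h L)) f) (+-congˡ (sumL-concatMap L h f))

  sumL-concatMap-map : ∀ {c'} {C : Set c'} (L : List B) (K : List C) (g : B → C → A) (f : A → Carrier) →
                       sumL (concatMap (λ y → map (g y) K) L) f ≈ sumL L (λ y → sumL K (λ z → f (g y z)))
  sumL-concatMap-map L K g f =
    trans (sumL-concatMap L _ f) (sumL-cong L (λ y → reflexive (sumL-map K (g y) f)))

  sumL-comm : (L : List A) (K : List B) (f : A → B → Carrier) →
              sumL L (λ x → sumL K (f x)) ≈ sumL K (λ y → sumL L (λ x → f x y))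
  sumL-comm []      K f = sym (sumL-zero K)
  sumL-comm (x ∷ L) K f = trans (+-congˡ (sumL-comm L K f)) (sym (sumL-distrib-+ K (f x) _))

  sumL-filter : {P : A → Set r} (P? : ∀ x → Dec (P x)) (L : List A) (f : A → Carrier) →
                sumL (filter P? L) f ≈ sumL L (λ x → if does (P? x) then f x else 0#)
  sumL-filter P? []      f = refl
  sumL-filter P? (x ∷ L) f with does (P? x)
  ... | true  = +-congˡ (sumL-filter P? L f)
  ... | false = trans (sumL-filter P? L f) (sym (+-identityˡ _))

  if-then-0-cong : ∀ {b b' u v} → b ≡ b' → u ≈ v → (if b then u else 0#) ≈ (if b' then v else 0#)
  if-then-0-cong {true}  ≡.refl u≈v = u≈v
  if-then-0-cong {false} ≡.refl _   = refl

  sumL-+-paired : (L : List A) (f g : A → Carrier) (r : A → A) {s : Carrier} →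
                  sumL L g ≈ sumL L (g ∘ r) → All (λ x → f x + g (r x) ≈ s) L →
                  sumL L f + sumL L g ≈ sumL L (λ _ → s)
  sumL-+-paired L f g r {s} g-inv pairs = begin
    sumL L f + sumL L g        ≈⟨ +-congˡ g-inv ⟩
    sumL L f + sumL L (g ∘ r)  ≈⟨ sumL-distrib-+ L f (g ∘ r) ⟨
    sumL L (λ x → f x + g (r x)) ≈⟨ sumL-cong-All pairs ⟩
    sumL L (λ _ → s)           ∎

  sumL-funs-suc : (L : List A) (φ : Vector A (suc k) → Carrier) →
                  sumL (funs (suc k) L) φ ≈ sumL L (λ x → sumL (funs k L) (λ f → φ (x ∷ᶠ f)))
  sumL-funs-suc {k = k} L φ = sumL-concatMap-map L (funs k L) _∷ᶠ_ φ

  -- Without function extensionality vectors are compared pointwise up to _~_; summands must respect this.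
  module _ {A : Set a} (_~_ : Rel A r) (~-refl : Reflexive _~_) where

    private
      Respects : (Vector A k → Carrier) → Set _
      Respects φ = φ Preserves Pointwise _~_ ⟶ _≈_

    _∷ʳ_ : Vector A k → A → Vector A (suc k)
    t ∷ʳ x = insertAt t (Fin.fromℕ _) x

    ∷ʳ-cong : ∀ {t t' : Vector A k} x → Pointwise _~_ t t' → Pointwise _~_ (t ∷ʳ x) (t' ∷ʳ x)
    ∷ʳ-cong {k = zero}  x t~t' zero    = ~-refl
    ∷ʳ-cong {k = suc k} x t~t' zero    = t~t' zero
    ∷ʳ-cong {k = suc k} x t~t' (suc i) = ∷ʳ-cong x (t~t' ∘ suc) i

    reverse-∷ : ∀ x (t : Vector A k) → reverse (x ∷ᶠ t) ≗ reverse t ∷ʳ x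
    reverse-∷ {k = zero}  x t zero    = ≡.refl
    reverse-∷ {k = suc k} x t zero    = ≡.refl
    reverse-∷ {k = suc k} x t (suc i) = ≡.trans (∷ᶠ-inject₁ (opposite i)) (reverse-∷ x (init t) i)
      where
      ∷ᶠ-inject₁ : ∀ j → (x ∷ᶠ t) (inject₁ j) ≡ (x ∷ᶠ init t) j
      ∷ᶠ-inject₁ zero    = ≡.refl
      ∷ᶠ-inject₁ (suc j) = ≡.refl

    sumL-funs-∷ʳ : ∀ k (L : List A) (φ : Vector A (suc k) → Carrier) → Respects φ →
                   sumL (funs (suc k) L) φ ≈ sumL (funs k L) (λ t → sumL L (λ x → φ (t ∷ʳ x)))
    sumL-funs-∷ʳ zero L φ φ-resp = begin
      sumL (funs 1 L) φ                       ≈⟨ sumL-funs-suc L φ ⟩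
      sumL L (λ x → φ (x ∷ᶠ (λ ())) + 0#)     ≈⟨ sumL-cong L (λ x → +-identityʳ _) ⟩
      sumL L (λ x → φ (x ∷ᶠ (λ ())))          ≈⟨ sumL-cong L (λ x → φ-resp (λ { zero → ~-refl })) ⟩
      sumL L (λ x → φ ((λ ()) ∷ʳ x))          ≈⟨ +-identityʳ _ ⟨
      sumL L (λ x → φ ((λ ()) ∷ʳ x)) + 0#     ∎
    sumL-funs-∷ʳ (suc k) L φ φ-resp = begin
      sumL (funs (suc (suc k)) L) φ
        ≈⟨ sumL-funs-suc L φ ⟩
      sumL L (λ y → sumL (funs (suc k) L) (λ f → φ (y ∷ᶠ f)))
        ≈⟨ sumL-cong L (λ y → sumL-funs-∷ʳ k L (λ f → φ (y ∷ᶠ f))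
                                (λ f~f' → φ-resp (λ { zero → ~-refl ; (suc i) → f~f' i }))) ⟩
      sumL L (λ y → sumL (funs k L) (λ t → sumL L (λ x → φ (y ∷ᶠ (t ∷ʳ x)))))
        ≈⟨ sumL-cong L (λ y → sumL-cong (funs k L) (λ t → sumL-cong L (λ x →
             φ-resp (λ { zero → ~-refl ; (suc i) → ~-refl })))) ⟩
      sumL L (λ y → sumL (funs k L) (λ t → sumL L (λ x → φ ((y ∷ᶠ t) ∷ʳ x))))
        ≈⟨ sumL-funs-suc L _ ⟨
      sumL (funs (suc k) L) (λ t → sumL L (λ x → φ (t ∷ʳ x))) ∎

    sumL-funs-reverse : ∀ k (L : List A) (φ : Vector A k → Carrier) → Respects φ →
                        sumL (funs k L) φ ≈ sumL (funs k L) (φ ∘ reverse)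
    sumL-funs-reverse zero    L φ φ-resp = +-congʳ (φ-resp (λ ()))
    sumL-funs-reverse (suc k) L φ φ-resp = begin
      sumL (funs (suc k) L) φ                                   ≈⟨ sumL-funs-∷ʳ k L φ φ-resp ⟩
      sumL (funs k L) ψ                                         ≈⟨ sumL-funs-reverse k L ψ ψ-resp ⟩
      sumL (funs k L) (λ t → sumL L (λ x → φ (reverse t ∷ʳ x)))  ≈⟨ sumL-comm (funs k L) L _ ⟩
      sumL L (λ x → sumL (funs k L) (λ t → φ (reverse t ∷ʳ x)))
        ≈⟨ sumL-cong L (λ x → sumL-cong (funs k L) (λ t → φ-resp (λ i → ≡⇒~ (reverse-∷ x t i)))) ⟨
      sumL L (λ x → sumL (funs k L) (λ t → φ (reverse (x ∷ᶠ t))))  ≈⟨ sumL-funs-suc L _ ⟨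
      sumL (funs (suc k) L) (φ ∘ reverse)                       ∎
      where
      ψ : Vector A k → Carrier
      ψ t = sumL L (λ x → φ (t ∷ʳ x))
      ψ-resp : Respects ψ
      ψ-resp t~t' = sumL-cong L (λ x → φ-resp (∷ʳ-cong x t~t'))
      ≡⇒~ : ∀ {x y} → x ≡ y → x ~ y
      ≡⇒~ ≡.refl = ~-refl

    sumL-funs-∘ : (L : List A) (ρ : A → A) →
                  (∀ (ψ : A → Carrier) → ψ Preserves _~_ ⟶ _≈_ → sumL L ψ ≈ sumL L (ψ ∘ ρ)) →
                  ∀ k (φ : Vector A k → Carrier) → Respects φ →
                  sumL (funs k L) φ ≈ sumL (funs k L) (λ f → φ (ρ ∘ f))
    sumL-funs-∘ L ρ L-inv zero    φ φ-resp = +-congʳ (φ-resp (λ ()))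
    sumL-funs-∘ L ρ L-inv (suc k) φ φ-resp = begin
      sumL (funs (suc k) L) φ                ≈⟨ sumL-funs-suc L φ ⟩
      sumL L Φ                               ≈⟨ L-inv Φ (λ x~y → sumL-cong (funs k L) (λ t →
                                                   φ-resp (λ { zero → x~y ; (suc i) → ~-refl }))) ⟩
      sumL L (Φ ∘ ρ)
        ≈⟨ sumL-cong L (λ y → sumL-funs-∘ L ρ L-inv k (λ t → φ (ρ y ∷ᶠ t))
                                (λ t~t' → φ-resp (λ { zero → ~-refl ; (suc i) → t~t' i }))) ⟩
      sumL L (λ y → sumL (funs k L) (λ t → φ (ρ y ∷ᶠ (ρ ∘ t))))
        ≈⟨ sumL-cong L (λ y → sumL-cong (funs k L) (λ t →
             φ-resp (λ { zero → ~-refl ; (suc i) → ~-refl }))) ⟩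
      sumL L (λ y → sumL (funs k L) (λ t → φ (ρ ∘ (y ∷ᶠ t))))  ≈⟨ sumL-funs-suc L _ ⟨
      sumL (funs (suc k) L) (λ f → φ (ρ ∘ f)) ∎
      where
      Φ : A → Carrier
      Φ y = sumL (funs k L) (λ t → φ (y ∷ᶠ t))

  sumL-Sym-reverse : ∀ n (φ : (Fin n → Fin n) → Carrier) → φ Preserves _≗_ ⟶ _≈_ →
                     sumL (Sym n) φ ≈ sumL (Sym n) (φ ∘ reverse)
  sumL-Sym-reverse n φ φ-resp = begin
    sumL (Sym n) φ                 ≈⟨ sumL-filter IsPerm? (funs n (allFin n)) φ ⟩
    sumL (funs n (allFin n)) ψ     ≈⟨ sumL-funs-reverse _≡_ ≡.refl n (allFin n) ψ ψ-resp ⟩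
    sumL (funs n (allFin n)) (ψ ∘ reverse)
      ≈⟨ sumL-cong (funs n (allFin n)) (λ f → if-then-0-cong (does-IsPerm-reverse f) refl) ⟩
    sumL (funs n (allFin n)) (λ f → if does (IsPerm? f) then φ (reverse f) else 0#)
      ≈⟨ sumL-filter IsPerm? (funs n (allFin n)) (φ ∘ reverse) ⟨
    sumL (Sym n) (φ ∘ reverse)     ∎
    where
    ψ : (Fin n → Fin n) → Carrier
    ψ f = if does (IsPerm? f) then φ f else 0#
    ψ-resp : ψ Preserves _≗_ ⟶ _≈_
    ψ-resp {f} {g} f≗g =
      if-then-0-cong (does-⇔ (mk⇔ (IsPerm-resp f≗g) (IsPerm-resp (≡.sym ∘ f≗g))) (IsPerm? f) (IsPerm? g))
                     (φ-resp f≗g)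
    does-IsPerm-reverse : ∀ f → does (IsPerm? (reverse f)) ≡ does (IsPerm? f)
    does-IsPerm-reverse f = does-⇔ (mk⇔ IsPerm-reverse⁻ IsPerm-reverse) (IsPerm? (reverse f)) (IsPerm? f)

  reverseEach : ∀ {n e'} → (Fin e' → Fin n → Fin n) → (Fin e' → Fin n → Fin n)
  reverseEach σ i = reverse (σ i)

  sumL-SymPow-reverseEach : ∀ n e' (F : (Fin e' → Fin n → Fin n) → Carrier) →
                            F Preserves Pointwise _≗_ ⟶ _≈_ →
                            sumL (SymPow n e') F ≈ sumL (SymPow n e') (F ∘ reverseEach)
  sumL-SymPow-reverseEach n e' =
    sumL-funs-∘ _≗_ (λ _ → ≡.refl) (Sym n) reverse (sumL-Sym-reverse n) e'

  sumF : ∀ n → (Fin n → Carrier) → Carrier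
  sumF n = sumL (allFin n)

  sumL-tabulate : ∀ {n} (g : Fin n → A) (f : A → Carrier) → sumL (tabulate g) f ≡ sum (f ∘ g)
  sumL-tabulate {n = zero}  g f = ≡.refl
  sumL-tabulate {n = suc n} g f = ≡.cong (f (g zero) +_) (sumL-tabulate (g ∘ suc) f)

  sumF-permute : ∀ n (f : Fin n → Carrier) {ρ : Fin n → Fin n} → IsPerm n ρ → sumF n (f ∘ ρ) ≈ sumF n f
  sumF-permute n f {ρ} ρ-perm = begin
    sumF n (f ∘ ρ)  ≡⟨ sumL-tabulate id (f ∘ ρ) ⟩
    sum (f ∘ ρ)     ≈⟨ sum-permute f (IsPerm⇒Permutation ρ-perm) ⟨
    sum f           ≡⟨ sumL-tabulate id f ⟨
    sumF n f        ∎

  sumF-reverse : ∀ n (f : Fin n → Carrier) → sumF n (reverse f) ≈ sumF n f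
  sumF-reverse n f = sumF-permute n f (IsPerm-reverse IsPerm-id)

  telescope : ∀ n (u : ℕ → Carrier) → sum (λ (i : Fin n) → u (suc (toℕ i)) - u (toℕ i)) ≈ u n - u 0
  telescope zero    u = sym (-‿inverseʳ (u 0))
  telescope (suc n) u = begin
    (u 1 - u 0) + sum (λ (i : Fin n) → u (suc (suc (toℕ i))) - u (suc (toℕ i)))
      ≈⟨ +-congˡ (telescope n (u ∘ suc)) ⟩
    (u 1 - u 0) + (u (suc n) - u 1)  ≈⟨ +-comm _ _ ⟩
    (u (suc n) - u 1) + (u 1 - u 0)  ≈⟨ +-assoc _ _ _ ⟩
    u (suc n) + (- u 1 + (u 1 - u 0))  ≈⟨ +-congˡ (+-assoc _ _ _) ⟨
    u (suc n) + ((- u 1 + u 1) - u 0)  ≈⟨ +-congˡ (+-congʳ (-‿inverseˡ (u 1))) ⟩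
    u (suc n) + (0# - u 0)           ≈⟨ +-congˡ (+-identityˡ _) ⟩
    u (suc n) - u 0                  ∎

  sumF-telescope : ∀ n (u : ℕ → Carrier) → sumF n (λ i → u (suc (toℕ i)) - u (toℕ i)) ≈ u n - u 0
  sumF-telescope n u = trans (reflexive (sumL-tabulate {n = n} id _)) (telescope n u)

module Centroid {c ℓ} (R : CommutativeRing c ℓ) (inv : ℕ → CommutativeRing.Carrier R)
  (inv-spec : ∀ k → CommutativeRing._≈_ R (CommutativeRing._*_ R (Setup.fromℕ R inv (suc k)) (inv (suc k)))
                                         (CommutativeRing.1# R)) where
  open CommutativeRing R hiding (zero)
  open FiniteSums R
  open Setup R inv
  open import Relation.Binary.Reasoning.Setoid setoid
  open import Algebra.Properties.CommutativeSemigroup *-commutativeSemigroup using (x∙yz≈y∙xz)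
  open import Algebra.Properties.CommutativeSemigroup +-commutativeSemigroup using (interchange)

  sumL-const : (L : List A) (s : Carrier) → sumL L (λ _ → s) ≈ fromℕ (length L) * s
  sumL-const []      s = sym (zeroˡ s)
  sumL-const (x ∷ L) s = begin
    s + sumL L (λ _ → s)          ≈⟨ +-cong (sym (*-identityˡ s)) (sumL-const L s) ⟩
    1# * s + fromℕ (length L) * s  ≈⟨ distribʳ s _ _ ⟨
    (1# + fromℕ (length L)) * s    ∎

  inv-cancel : ∀ k s → inv (suc k) * (fromℕ (suc k) * s) ≈ s
  inv-cancel k s = begin
    inv (suc k) * (fromℕ (suc k) * s)  ≈⟨ *-assoc _ _ _ ⟨
    (inv (suc k) * fromℕ (suc k)) * s  ≈⟨ *-congʳ (trans (*-comm _ _) (inv-spec k)) ⟩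
    1# * s                             ≈⟨ *-identityˡ s ⟩
    s                                  ∎

  mean-half : (L : List A) → Any (λ _ → ⊤) L → ∀ {T s} →
              T + T ≈ fromℕ (length L) * s → inv (length L) * T ≈ inv 2 * s
  mean-half L@(_ ∷ L') _ {T} {s} 2T≈Ns = begin
    inv N * T                        ≈⟨ *-congˡ (inv-cancel 1 T) ⟨
    inv N * (inv 2 * (fromℕ 2 * T))  ≈⟨ *-congˡ (*-congˡ two*T) ⟩
    inv N * (inv 2 * (T + T))        ≈⟨ *-congˡ (*-congˡ 2T≈Ns) ⟩
    inv N * (inv 2 * (fromℕ N * s))  ≈⟨ x∙yz≈y∙xz _ _ _ ⟩
    inv 2 * (inv N * (fromℕ N * s))  ≈⟨ *-congˡ (inv-cancel (length L') s) ⟩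
    inv 2 * s                        ∎
    where
    N : ℕ
    N = length L
    two*T : fromℕ 2 * T ≈ T + T
    two*T = begin
      (1# + (1# + 0#)) * T  ≈⟨ *-congʳ (+-congˡ (+-identityʳ 1#)) ⟩
      (1# + 1#) * T         ≈⟨ distribʳ T 1# 1# ⟩
      1# * T + 1# * T       ≈⟨ +-cong (*-identityˡ T) (*-identityˡ T) ⟩
      T + T                 ∎

  module _ {d : ℕ} (t : Fin d) where

    ΣL-coord : (ps : List (Point d)) → ΣL ps t ≡ sumL ps (λ p → p t)
    ΣL-coord []       = ≡.refl
    ΣL-coord (p ∷ ps) = ≡.cong (p t +_) (ΣL-coord ps)

    ΣL-map-coord : (L : List A) (f : A → Point d) → ΣL (map f L) t ≡ sumL L (λ x → f x t)
    ΣL-map-coord L f = ≡.trans (ΣL-coord (map f L)) (sumL-map L f (λ p → p t))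

    if-coord : ∀ b (p : Point d) → (if b then p else 𝟎) t ≡ (if b then p t else 0#)
    if-coord true  p = ≡.refl
    if-coord false p = ≡.refl

  module Edge {d v' e' : ℕ} (tl hd : Fin e' → Fin v') (k : ℕ)
              (x' : Fin v' → Point d) (x : Fin e' → Fin (suc k) → Point d) (i : Fin e') (t : Fin d) where

    private
      m n : ℕ
      m = suc k
      n = suc m

    open Subdivision tl hd n x' x

    x₀ xₙ : Carrier
    x₀ = x' (tl i) t
    xₙ = x' (hd i) t

    pos-last : pos i n ≡ x' (hd i)
    pos-last with m ℕ.<? m
    ... | yes m<m = ⊥-elim (ℕ.<-irrefl ≡.refl m<m)
    ... | no  _   = ≡.refl

    W : Fin n → Carrier
    W l = w i l t

    sumF-W : sumF n W ≈ xₙ - x₀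
    sumF-W = trans (sumF-telescope n (λ j → pos i j t)) (reflexive (≡.cong (λ p → p t - x₀) pos-last))

    prefix : (Fin n → Fin n) → Fin m → Carrier
    prefix ρ j = sumF n (λ l → if toℕ l ≤ᵇ toℕ j then W (ρ l) else 0#)

    prefix-cong : ∀ {ρ ρ'} j → ρ ≗ ρ' → prefix ρ j ≈ prefix ρ' j
    prefix-cong j ρ≗ρ' =
      sumL-cong (allFin n) (λ l → if-then-0-cong ≡.refl (reflexive (≡.cong W (ρ≗ρ' l))))

    -- Reversing ρ turns the prefix up to j into the complementary suffix, and together they sum all steps.
    prefix-reverse : ∀ {ρ} j → IsPerm n ρ → prefix ρ j + prefix (reverse ρ) (opposite j) ≈ xₙ - x₀
    prefix-reverse {ρ} j ρ-perm = begin
      prefix ρ j + prefix (reverse ρ) (opposite j)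
        ≈⟨ +-congˡ (sumL-cong (allFin n) (λ l → if-then-0-cong
             (≡.cong (λ l' → toℕ l' ≤ᵇ toℕ (opposite j)) (opposite-involutive l)) refl)) ⟨
      prefix ρ j + sumF n (reverse suffix)   ≈⟨ +-congˡ (sumF-reverse n suffix) ⟩
      prefix ρ j + sumF n suffix             ≈⟨ sumL-distrib-+ (allFin n) _ suffix ⟨
      sumF n (λ l → (if toℕ l ≤ᵇ toℕ j then W (ρ l) else 0#) + suffix l)
        ≈⟨ sumL-cong (allFin n) (λ l →
             trans (+-congˡ (if-then-0-cong (≤ᵇ-opposite l j) refl))
                   (if-then-0-+-not (toℕ l ≤ᵇ toℕ j) (W (ρ l)))) ⟩
      sumF n (W ∘ ρ)                         ≈⟨ sumF-permute n W ρ-perm ⟩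
      sumF n W                               ≈⟨ sumF-W ⟩
      xₙ - x₀                                ∎
      where
      suffix : Fin n → Carrier
      suffix l = if toℕ (opposite l) ≤ᵇ toℕ (opposite j) then W (ρ l) else 0#
      if-then-0-+-not : ∀ b u → (if b then u else 0#) + (if not b then u else 0#) ≈ u
      if-then-0-+-not true  u = +-identityʳ u
      if-then-0-+-not false u = +-identityˡ u

    X : (Fin e' → Fin n → Fin n) → Fin m → Carrier
    X σ j = xσ σ i j t

    X≈prefix : ∀ σ j → X σ j ≈ x₀ + prefix (σ i) j
    X≈prefix σ j = +-congˡ (trans (reflexive (ΣL-map-coord t (allFin n) _))
                                  (sumL-cong (allFin n) (λ l → reflexive (if-coord t _ (w i (σ i l))))))

    X-cong : ∀ j {σ σ'} → Pointwise _≗_ σ σ' → X σ j ≈ X σ' j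
    X-cong j {σ} {σ'} σ≗σ' =
      trans (X≈prefix σ j) (trans (+-congˡ (prefix-cong j (σ≗σ' i))) (sym (X≈prefix σ' j)))

    X-reverseEach : ∀ {σ} j → (∀ i' → IsPerm n (σ i')) →
                    X σ j + X (reverseEach σ) (opposite j) ≈ xₙ + x₀
    X-reverseEach {σ} j σ-perm = begin
      X σ j + X (reverseEach σ) (opposite j)
        ≈⟨ +-cong (X≈prefix σ j) (X≈prefix (reverseEach σ) (opposite j)) ⟩
      (x₀ + prefix (σ i) j) + (x₀ + prefix (reverse (σ i)) (opposite j))  ≈⟨ interchange _ _ _ _ ⟩
      (x₀ + x₀) + (prefix (σ i) j + prefix (reverse (σ i)) (opposite j))
        ≈⟨ +-congˡ (prefix-reverse j (σ-perm i)) ⟩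
      (x₀ + x₀) + (xₙ - x₀)                                            ≈⟨ interchange _ _ _ _ ⟩
      (x₀ + xₙ) + (x₀ - x₀)                                            ≈⟨ +-congˡ (-‿inverseʳ x₀) ⟩
      (x₀ + xₙ) + 0#                                                   ≈⟨ +-identityʳ _ ⟩
      x₀ + xₙ                                                          ≈⟨ +-comm x₀ xₙ ⟩
      xₙ + x₀                                                          ∎

    X-sum-reverseEach : ∀ j → sumL S (λ σ → X σ j) ≈ sumL S (λ σ → X (reverseEach σ) j)
    X-sum-reverseEach j = sumL-SymPow-reverseEach n e' (λ σ → X σ j) (X-cong j)

    X-pairs : ∀ j → All (λ σ → X σ j + X (reverseEach σ) (opposite j) ≈ xₙ + x₀) S
    X-pairs j = All.map (X-reverseEach j) (All-SymPow n e')

    ΣL-P : ΣL (P i) t ≈ sumF m (λ j → sumL S (λ σ → X σ j))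
    ΣL-P = trans (reflexive (ΣL-coord t (P i)))
                 (sumL-concatMap-map (allFin m) S (λ j σ → xσ σ i j) (λ p → p t))

    ΣL-P-double : ΣL (P i) t + ΣL (P i) t ≈ fromℕ (length (P i)) * (xₙ + x₀)
    ΣL-P-double = begin
      ΣL (P i) t + ΣL (P i) t                                    ≈⟨ +-cong ΣL-P ΣL-P ⟩
      sumF m G + sumF m G
        ≈⟨ sumL-+-paired (allFin m) G G opposite (sym (sumF-reverse m G)) (All.tabulate⁺ G-pairs) ⟩
      sumF m (λ _ → sumL S (λ _ → xₙ + x₀))
        ≈⟨ sumL-concatMap-map (allFin m) S (λ j σ → xσ σ i j) (λ _ → xₙ + x₀) ⟨
      sumL (P i) (λ _ → xₙ + x₀)                                  ≈⟨ sumL-const (P i) (xₙ + x₀) ⟩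
      fromℕ (length (P i)) * (xₙ + x₀)                           ∎
      where
      G : Fin m → Carrier
      G j = sumL S (λ σ → X σ j)
      G-pairs : ∀ j → G j + G (opposite j) ≈ sumL S (λ _ → xₙ + x₀)
      G-pairs j = sumL-+-paired S (λ σ → X σ j) (λ σ → X σ (opposite j)) reverseEach
                    (X-sum-reverseEach (opposite j)) (X-pairs j)

    μ-P : μ (P i) t ≈ m' i t
    μ-P = mean-half (P i) P-nonempty ΣL-P-double
      where
      P-nonempty : Any (λ _ → ⊤) (P i)
      P-nonempty = Any.concatMap⁺ (λ j → map (λ σ → xσ σ i j) S) {xs = allFin m}
                                  (here (Any.map⁺ (SymPow-nonempty n e')))

    V : (Fin e' → Fin n → Fin n) → Carrier
    V σ = inv m * sumF m (X σ)

    μ-Xσ : ∀ σ → μ (Xσ σ i) t ≈ V σ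
    μ-Xσ σ = reflexive (≡.cong₂ (λ N T → inv N * T)
                                (≡.trans (length-map _ (allFin m)) (length-tabulate {n = m} id))
                                                     (ΣL-map-coord t (allFin m) (xσ σ i)))

    V-reverseEach : ∀ {σ} → (∀ i' → IsPerm n (σ i')) → V σ + V (reverseEach σ) ≈ xₙ + x₀
    V-reverseEach {σ} σ-perm = begin
      inv m * sumF m (X σ) + inv m * sumF m (X (reverseEach σ))  ≈⟨ distribˡ _ _ _ ⟨
      inv m * (sumF m (X σ) + sumF m (X (reverseEach σ)))
        ≈⟨ *-congˡ (sumL-+-paired (allFin m) (X σ) (X (reverseEach σ)) opposite
                     (sym (sumF-reverse m _)) (All.tabulate⁺ (λ j → X-reverseEach j σ-perm))) ⟩
      inv m * sumF m (λ _ → xₙ + x₀)                            ≈⟨ *-congˡ (sumL-const (allFin m) _) ⟩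
      inv m * (fromℕ (length (allFin m)) * (xₙ + x₀))
        ≡⟨ ≡.cong (λ N → inv m * (fromℕ N * (xₙ + x₀))) (length-tabulate {n = m} id) ⟩
      inv m * (fromℕ m * (xₙ + x₀))                             ≈⟨ inv-cancel k _ ⟩
      xₙ + x₀                                                   ∎

    ΣL-M-double : ΣL (M i) t + ΣL (M i) t ≈ fromℕ (length (M i)) * (xₙ + x₀)
    ΣL-M-double = begin
      ΣL (M i) t + ΣL (M i) t          ≈⟨ +-cong ΣL-M ΣL-M ⟩
      sumL S V + sumL S V
        ≈⟨ sumL-+-paired S V V reverseEach (sumL-SymPow-reverseEach n e' V V-cong)
                         (All.map V-reverseEach (All-SymPow n e')) ⟩
      sumL S (λ _ → xₙ + x₀)           ≈⟨ sumL-const S _ ⟩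
      fromℕ (length S) * (xₙ + x₀)     ≡⟨ ≡.cong (λ N → fromℕ N * (xₙ + x₀)) (length-map _ S) ⟨
      fromℕ (length (M i)) * (xₙ + x₀) ∎
      where
      ΣL-M : ΣL (M i) t ≈ sumL S V
      ΣL-M = trans (reflexive (ΣL-map-coord t S (λ σ → μ (Xσ σ i)))) (sumL-cong S μ-Xσ)
      V-cong : V Preserves Pointwise _≗_ ⟶ _≈_
      V-cong σ≗σ' = *-congˡ (sumL-cong (allFin m) (λ j → X-cong j σ≗σ'))

    μ-M : μ (M i) t ≈ m' i t
    μ-M = mean-half (M i) (Any.map⁺ (SymPow-nonempty n e')) ΣL-M-double

lemma4 : ∀ {c ℓ : Level} (R : CommutativeRing c ℓ)
           (inv : ℕ → CommutativeRing.Carrier R)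
           (inv-spec : ∀ k → CommutativeRing._≈_ R
                         (CommutativeRing._*_ R (Setup.fromℕ R inv (suc k)) (inv (suc k)))
                         (CommutativeRing.1# R))
           (d v' e' : ℕ) (tl hd : Fin e' → Fin v') (n : ℕ) → 2 ≤ n →
           (x' : Fin v' → Setup.Point R inv d)
           (x : Fin e' → Fin (n ∸ 1) → Setup.Point R inv d)
           (i : Fin e') →
           Setup._≈ₚ_ R inv (Setup.μ R inv (Setup.Subdivision.P R inv tl hd n x' x i))
                            (Setup.Subdivision.m' R inv tl hd n x' x i)
           × Setup._≈ₚ_ R inv (Setup.μ R inv (Setup.Subdivision.M R inv tl hd n x' x i))
                              (Setup.Subdivision.m' R inv tl hd n x' x i)
lemma4 R inv inv-spec d v' e' tl hd (suc (suc k)) (s≤s (s≤s z≤n)) x' x i =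
  (λ t → Edge.μ-P tl hd k x' x i t) , (λ t → Edge.μ-M tl hd k x' x i t)
  where open Centroid R inv inv-spec
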